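{- Let $b\geq 2$ be an integer. For all integers $n\geq 0$ and $k\geq 1$, \[ \bar{s}_b(n,n+bk)\leq \bar{s}_b(n,n+k)+\frac{b-1}{2}. \] Moreover, equality holds for every $k\geq1$ when $n=0$.
   Context: For an integer $b\geq 2$ and $n\in\mathbb{Z}_{\ge 0}$, $s_b(n)$ is the sum of the base-$b$ digits of $n$, and $S_b(N)=\sum_{n=0}^{N-1}s_b(n)$. For integers $0\leq s<t$, $\bar{s}_b(s,t)=\frac{S_b(t)-S_b(s)}{t-s}=\frac{1}{t-s}\sum_{r=s}^{t-1}s_b(r)$. -}

module Defs where

open import Data.Nat using (ℕ; zero; suc; _+_; _*_; _∸_; _≤_; NonZero)
open import Data.Nat.DivMod using (_/_; _%_)
import Data.Integer as ℤ
open import Data.Rational using (ℚ)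
import Data.Rational as ℚ

-- digit sum with fuel; fuel n suffices for input n (each step strictly decreases n when b ≥ 2)
digitSumFuel : (b : ℕ) → .{{NonZero b}} → ℕ → ℕ → ℕ
digitSumFuel b zero    n = 0
digitSumFuel b (suc f) zero = 0
digitSumFuel b (suc f) n@(suc _) = n % b + digitSumFuel b f (n / b)

-- s_b(n): sum of base-b digits of n (meaningful for b ≥ 2)
s : (b : ℕ) → .{{NonZero b}} → ℕ → ℕ
s b n = digitSumFuel b n n

S : (b : ℕ) → .{{NonZero b}} → ℕ → ℕ
S b zero    = 0
S b (suc N) = S b N + s b N

sbar : (b : ℕ) → .{{NonZero b}} → (u t : ℕ) → .{{NonZero (t ∸ u)}} → ℚ
sbar b u t = (ℤ.+ S b t ℤ.- ℤ.+ S b u) ℚ./ (t ∸ u)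

module Submission where

-- Write s = s_b, ∑ f L = Σ_{j<L} f j and window f n L = Σ_{j<L} f (n + j).  Since
-- s̄_b(n, n + L) = window s n L / L, the theorem says, after clearing denominators,
--   2 · window s n (b k) ≤ 2 b · window s n k + k b (b - 1),  with equality for n = 0.
-- The equality at n = 0 is an exact block formula: appending a last digit d < b to k
-- gives s(b k + d) = s(k) + d.  For the inequality, call f a-comparable at (n, k) when
--   ∑ f (a k) + a · window f n k ≤ window f n (a k) + a · ∑ f k.
-- (1) This is closed under sums and scalar multiples, and holds with equality for the
--     identity, whose windows are linear in n.
-- (2) Every floor function ⌊x/B⌋ is comparable, by superadditivity of the window sum
--     z ↦ Σ_{i<c} ⌊(z + i)/B⌋ for c ≤ B.
-- (3) Hence D(x) = x - s(x) = (b - 1) Σ_{i≥1} ⌊x/bⁱ⌋ is b-comparable, and since s = id - D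
--     the digit sum satisfies the reversed inequality; combined with the block formula
--     this is the cleared-denominator form of the theorem.

open import Defs
open import Data.Nat
open import Data.Nat.Properties
open import Data.Nat.DivMod
open import Data.Nat.Divisibility using (n∣m*n)
open import Data.Nat.Tactic.RingSolver using (solve-∀)
open import Data.Product using (_×_; _,_)
open import Relation.Binary.PropositionalEquality
open import Relation.Nullary using (yes; no)
import Data.Integer as ℤ
import Data.Integer.Properties as ℤP
import Data.Rational as ℚ
import Data.Rational.Properties as ℚP
import Data.Rational.Unnormalised as ℚᵘ
import Data.Rational.Unnormalised.Properties as ℚᵘP

∑ : (ℕ → ℕ) → ℕ → ℕ
∑ f zero    = 0
∑ f (suc L) = ∑ f L + f L

window : (ℕ → ℕ) → ℕ → ℕ → ℕ
window f n L = ∑ (λ j → f (n + j)) L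

∑-cong : ∀ {f h : ℕ → ℕ} L → (∀ j → j < L → f j ≡ h j) → ∑ f L ≡ ∑ h L
∑-cong zero    eq = refl
∑-cong (suc L) eq = cong₂ _+_ (∑-cong L (λ j j<L → eq j (m<n⇒m<1+n j<L))) (eq L ≤-refl)

∑-const : ∀ c L → ∑ (λ _ → c) L ≡ L * c
∑-const c zero    = refl
∑-const c (suc L) = trans (cong (_+ c) (∑-const c L)) (+-comm (L * c) c)

∑-vanish : ∀ (f : ℕ → ℕ) L → (∀ j → j < L → f j ≡ 0) → ∑ f L ≡ 0
∑-vanish f L eq = trans (∑-cong L eq) (trans (∑-const 0 L) (*-zeroʳ L))

∑-+ : ∀ (f h : ℕ → ℕ) L → ∑ (λ j → f j + h j) L ≡ ∑ f L + ∑ h L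
∑-+ f h zero    = refl
∑-+ f h (suc L) = trans (cong (_+ (f L + h L)) (∑-+ f h L)) (interchange (∑ f L) (∑ h L) (f L) (h L))
  where
  interchange : ∀ w x y z → (w + x) + (y + z) ≡ (w + y) + (x + z)
  interchange = solve-∀

∑-scale : ∀ c (f : ℕ → ℕ) L → ∑ (λ j → c * f j) L ≡ c * ∑ f L
∑-scale c f zero    = sym (*-zeroʳ c)
∑-scale c f (suc L) = trans (cong (_+ c * f L) (∑-scale c f L)) (sym (*-distribˡ-+ c (∑ f L) (f L)))

∑-split : ∀ (f : ℕ → ℕ) A B → ∑ f (A + B) ≡ ∑ f A + window f A B
∑-split f A zero    = trans (cong (∑ f) (+-identityʳ A)) (sym (+-identityʳ (∑ f A)))
∑-split f A (suc B) = begin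
  ∑ f (A + suc B)                          ≡⟨ cong (∑ f) (+-suc A B) ⟩
  ∑ f (A + B) + f (A + B)                  ≡⟨ cong (_+ f (A + B)) (∑-split f A B) ⟩
  ∑ f A + window f A B + f (A + B)         ≡⟨ +-assoc (∑ f A) (window f A B) (f (A + B)) ⟩
  ∑ f A + (window f A B + f (A + B))       ∎
  where open ≡-Reasoning

-- Both sides are ∑ f (c + x), split at c or at x.
window-swap : ∀ (f : ℕ → ℕ) c x → ∑ f c + window f c x ≡ ∑ f x + window f x c
window-swap f c x = trans (sym (∑-split f c x)) (trans (cong (∑ f) (+-comm c x)) (∑-split f x c))

triangle : ℕ → ℕ
triangle L = ∑ (λ j → j) L

triangle-doubled : ∀ L → 2 * triangle L + L ≡ L * L
triangle-doubled zero    = refl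
triangle-doubled (suc L) = begin
  2 * (T + L) + suc L        ≡⟨ regroup T L ⟩
  (2 * T + L) + (1 + 2 * L)  ≡⟨ cong (_+ (1 + 2 * L)) (triangle-doubled L) ⟩
  L * L + (1 + 2 * L)        ≡⟨ square L ⟩
  suc L * suc L              ∎
  where
  open ≡-Reasoning
  T : ℕ
  T = triangle L
  regroup : ∀ t l → 2 * (t + l) + suc l ≡ (2 * t + l) + (1 + 2 * l)
  regroup = solve-∀
  square : ∀ l → l * l + (1 + 2 * l) ≡ suc l * suc l
  square = solve-∀

-- For a scale factor a, a function f, a start n
-- and a length k, compare the mean of f on [n, n + ak) with its mean on [n, n + k),
-- both measured against the same comparison on the initial segments [0, ak), [0, k).
lower upper : ℕ → (ℕ → ℕ) → ℕ → ℕ → ℕ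
lower a f n k = ∑ f (a * k) + a * window f n k
upper a f n k = window f n (a * k) + a * ∑ f k

Comparable : ℕ → (ℕ → ℕ) → ℕ → ℕ → Set
Comparable a f n k = lower a f n k ≤ upper a f n k

-- Both sides have the shape ∑ P A + a · ∑ Q B, which is linear in the pair (P, Q).
pair-cong : ∀ {P P' Q Q' : ℕ → ℕ} A a B → (∀ x → P x ≡ P' x) → (∀ x → Q x ≡ Q' x) →
            ∑ P A + a * ∑ Q B ≡ ∑ P' A + a * ∑ Q' B
pair-cong A a B eqP eqQ = cong₂ (λ u v → u + a * v) (∑-cong A (λ j _ → eqP j)) (∑-cong B (λ j _ → eqQ j))

pair-+ : ∀ (P P' Q Q' : ℕ → ℕ) A a B →
         ∑ (λ x → P x + P' x) A + a * ∑ (λ x → Q x + Q' x) B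
         ≡ (∑ P A + a * ∑ Q B) + (∑ P' A + a * ∑ Q' B)
pair-+ P P' Q Q' A a B =
  trans (cong₂ (λ u v → u + a * v) (∑-+ P P' A) (∑-+ Q Q' B)) (regroup (∑ P A) (∑ P' A) a (∑ Q B) (∑ Q' B))
  where
  regroup : ∀ p p' a q q' → (p + p') + a * (q + q') ≡ (p + a * q) + (p' + a * q')
  regroup = solve-∀

pair-scale : ∀ c (P Q : ℕ → ℕ) A a B →
             ∑ (λ x → c * P x) A + a * ∑ (λ x → c * Q x) B ≡ c * (∑ P A + a * ∑ Q B)
pair-scale c P Q A a B =
  trans (cong₂ (λ u v → u + a * v) (∑-scale c P A) (∑-scale c Q B)) (regroup c (∑ P A) a (∑ Q B))
  where
  regroup : ∀ c p a q → c * p + a * (c * q) ≡ c * (p + a * q)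
  regroup = solve-∀

comparable-cong : ∀ a {f h} n k → (∀ x → f x ≡ h x) → Comparable a h n k → Comparable a f n k
comparable-cong a {f} {h} n k eq =
  subst₂ _≤_ (sym (pair-cong (a * k) a k eq (λ j → eq (n + j))))
             (sym (pair-cong (a * k) a k (λ j → eq (n + j)) eq))

comparable-+ : ∀ a f h n k → Comparable a f n k → Comparable a h n k →
               Comparable a (λ x → f x + h x) n k
comparable-+ a f h n k cf ch =
  subst₂ _≤_ (sym (pair-+ f h (λ j → f (n + j)) (λ j → h (n + j)) (a * k) a k))
             (sym (pair-+ (λ j → f (n + j)) (λ j → h (n + j)) f h (a * k) a k))
             (+-mono-≤ cf ch)

comparable-scale : ∀ a c f n k → Comparable a f n k → Comparable a (λ x → c * f x) n k
comparable-scale a c f n k cf =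
  subst₂ _≤_ (sym (pair-scale c f (λ j → f (n + j)) (a * k) a k))
             (sym (pair-scale c (λ j → f (n + j)) f (a * k) a k))
             (*-monoʳ-≤ c cf)

window-id : ∀ n L → window (λ x → x) n L ≡ L * n + triangle L
window-id n L = trans (∑-+ (λ _ → n) (λ j → j) L) (cong (_+ triangle L) (∑-const n L))

-- The identity satisfies the comparison with equality, since its windows depend linearly on n.
identity-balanced : ∀ a n k → lower a (λ x → x) n k ≡ upper a (λ x → x) n k
identity-balanced a n k = begin
  T (a * k) + a * window (λ x → x) n k  ≡⟨ cong (λ w → T (a * k) + a * w) (window-id n k) ⟩
  T (a * k) + a * (k * n + T k)         ≡⟨ regroup (T (a * k)) a k n (T k) ⟩
  ((a * k) * n + T (a * k)) + a * T k   ≡⟨ cong (_+ a * T k) (sym (window-id n (a * k))) ⟩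
  window (λ x → x) n (a * k) + a * T k  ∎
  where
  open ≡-Reasoning
  T : ℕ → ℕ
  T = triangle
  regroup : ∀ t a k n t' → t + a * (k * n + t') ≡ ((a * k) * n + t) + a * t'
  regroup = solve-∀

complement-reverses : ∀ a f h n k → (∀ x → f x + h x ≡ x) → Comparable a h n k →
                      upper a f n k ≤ lower a f n k
complement-reverses a f h n k f+h≡id ch = +-cancelʳ-≤ (upper a h n k) _ _ (begin
  upper a f n k + upper a h n k                ≡⟨ sym (pair-+ (λ j → f (n + j)) (λ j → h (n + j)) f h (a * k) a k) ⟩
  upper a (λ x → f x + h x) n k                ≡⟨ pair-cong (a * k) a k (λ j → f+h≡id (n + j)) f+h≡id ⟩
  upper a (λ x → x) n k                        ≡⟨ sym (identity-balanced a n k) ⟩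
  lower a (λ x → x) n k                        ≡⟨ sym (pair-cong (a * k) a k f+h≡id (λ j → f+h≡id (n + j))) ⟩
  lower a (λ x → f x + h x) n k                ≡⟨ pair-+ f h (λ j → f (n + j)) (λ j → h (n + j)) (a * k) a k ⟩
  lower a f n k + lower a h n k                ≤⟨ +-monoʳ-≤ (lower a f n k) ch ⟩
  lower a f n k + upper a h n k                ∎)
  where open ≤-Reasoning

-- The heart is that the window sum Ω(z) = Σ_{i<c} ⌊(z + i)/B⌋ is superadditive
-- in z when c ≤ B; the comparison is then a rearrangement of a · Ω(k) ≤ Ω(a k).
module FloorComparison (B-1 : ℕ) where
  B : ℕ
  B = suc B-1

  quot : ℕ → ℕ
  quot x = x / B

  quot-+-multiple : ∀ x m → quot (x + m * B) ≡ quot x + m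
  quot-+-multiple x m = trans (+-distrib-/-∣ʳ x (n∣m*n m)) (cong (quot x +_) (m*n/n≡m m B))

  window-periodic : ∀ c z m → window quot (z + m * B) c ≡ window quot z c + c * m
  window-periodic c z m = begin
    window quot (z + m * B) c        ≡⟨ ∑-cong c (λ i _ → trans (cong quot (swap z (m * B) i)) (quot-+-multiple (z + i) m)) ⟩
    ∑ (λ i → quot (z + i) + m) c     ≡⟨ ∑-+ (λ i → quot (z + i)) (λ _ → m) c ⟩
    window quot z c + ∑ (λ _ → m) c  ≡⟨ cong (window quot z c +_) (∑-const m c) ⟩
    window quot z c + c * m          ∎
    where
    open ≡-Reasoning
    swap : ∀ x y z → x + y + z ≡ x + z + y
    swap = solve-∀

  window-reduce : ∀ z c → window quot z c ≡ window quot (z % B) c + c * (z / B)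
  window-reduce z c = trans (cong (λ w → window quot w c) (m≡m%n+[m/n]*n z B)) (window-periodic c (z % B) (z / B))

  overflow-step : ∀ t → t < B + B → t ∸ B + quot t ≡ suc t ∸ B
  overflow-step t t<2B with B ≤? t
  ... | yes B≤t = begin
    t ∸ B + quot t          ≡⟨ cong (t ∸ B +_) (m/n≡1+[m∸n]/n B≤t) ⟩
    t ∸ B + suc ((t ∸ B) / B) ≡⟨ cong (λ q → t ∸ B + suc q) (m<n⇒m/n≡0 (m<n+o⇒m∸n<o t B t<2B)) ⟩
    t ∸ B + 1               ≡⟨ sym (+-∸-comm 1 B≤t) ⟩
    (t + 1) ∸ B             ≡⟨ cong (_∸ B) (+-comm t 1) ⟩
    suc t ∸ B               ∎
    where open ≡-Reasoning
  ... | no B≰t = begin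
    t ∸ B + quot t          ≡⟨ cong₂ _+_ (m≤n⇒m∸n≡0 (<⇒≤ t<B)) (m<n⇒m/n≡0 t<B) ⟩
    0                       ≡⟨ sym (m≤n⇒m∸n≡0 t<B) ⟩
    suc t ∸ B               ∎
    where
    open ≡-Reasoning
    t<B : t < B
    t<B = ≰⇒> B≰t

  window-residue : ∀ c z → z < B → c ≤ B → window quot z c ≡ (z + c) ∸ B
  window-residue zero    z z<B _   = sym (m≤n⇒m∸n≡0 (≤-trans (≤-reflexive (+-identityʳ z)) (<⇒≤ z<B)))
  window-residue (suc c) z z<B c<B = begin
    window quot z c + quot (z + c)  ≡⟨ cong (_+ quot (z + c)) (window-residue c z z<B (<⇒≤ c<B)) ⟩
    (z + c) ∸ B + quot (z + c)      ≡⟨ overflow-step (z + c) (+-mono-< z<B c<B) ⟩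
    suc (z + c) ∸ B                 ≡⟨ cong (_∸ B) (sym (+-suc z c)) ⟩
    (z + suc c) ∸ B                 ∎
    where open ≡-Reasoning

  overflow≤ : ∀ r c → r < B → (r + c) ∸ B ≤ c
  overflow≤ r c r<B = m≤n+o⇒m∸n≤o (r + c) B (+-monoˡ-≤ c (<⇒≤ r<B))

  overflow-superadditive : ∀ r₁ r₂ c → c ≤ B → ((r₁ + c) ∸ B) + ((r₂ + c) ∸ B) ≤ (r₁ + r₂ + c) ∸ B
  overflow-superadditive r₁ r₂ c c≤B with B ≤? r₁ + c
  ... | yes B≤r₁+c = begin
    ((r₁ + c) ∸ B) + ((r₂ + c) ∸ B)  ≤⟨ +-monoʳ-≤ ((r₁ + c) ∸ B) (m≤n+o⇒m∸n≤o (r₂ + c) B r₂+c≤B+r₂) ⟩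
    (r₁ + c) ∸ B + r₂            ≡⟨ sym (+-∸-comm r₂ B≤r₁+c) ⟩
    (r₁ + c + r₂) ∸ B            ≡⟨ cong (_∸ B) (swap r₁ c r₂) ⟩
    (r₁ + r₂ + c) ∸ B            ∎
    where
    open ≤-Reasoning
    r₂+c≤B+r₂ : r₂ + c ≤ B + r₂
    r₂+c≤B+r₂ = ≤-trans (≤-reflexive (+-comm r₂ c)) (+-monoˡ-≤ r₂ c≤B)
    swap : ∀ x y z → x + y + z ≡ x + z + y
    swap = solve-∀
  ... | no B≰r₁+c = begin
    ((r₁ + c) ∸ B) + ((r₂ + c) ∸ B)  ≡⟨ cong (_+ ((r₂ + c) ∸ B)) (m≤n⇒m∸n≡0 (<⇒≤ (≰⇒> B≰r₁+c))) ⟩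
    (r₂ + c) ∸ B                 ≤⟨ ∸-monoˡ-≤ B (+-monoˡ-≤ c (m≤n+m r₂ r₁)) ⟩
    (r₁ + r₂ + c) ∸ B            ∎
    where open ≤-Reasoning

  overflow-wrap : ∀ r₁ r₂ c t → r₁ < B → r₂ < B → c ≤ B → r₁ + r₂ ≡ t + B →
                  ((r₁ + c) ∸ B) + ((r₂ + c) ∸ B) ≤ (t + c) ∸ B + c
  overflow-wrap r₁ r₂ c t r₁<B r₂<B c≤B r₁+r₂≡t+B with B ≤? r₁ + c | B ≤? r₂ + c
  ... | yes B≤r₁+c | yes B≤r₂+c = +-cancelʳ-≤ B _ _ (begin
    u + v + B                ≡⟨ +-cancelʳ-≡ B _ _ total ⟩
    t + c + c                ≤⟨ +-monoˡ-≤ c (m≤n+m∸n (t + c) B) ⟩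
    B + ((t + c) ∸ B) + c    ≡⟨ rotate B ((t + c) ∸ B) c ⟩
    (t + c) ∸ B + c + B      ∎)
    where
    open ≤-Reasoning
    u v : ℕ
    u = (r₁ + c) ∸ B
    v = (r₂ + c) ∸ B
    pair : ∀ u v B → u + v + B + B ≡ (u + B) + (v + B)
    pair = solve-∀
    spread : ∀ r₁ r₂ c → (r₁ + c) + (r₂ + c) ≡ (r₁ + r₂) + c + c
    spread = solve-∀
    collect : ∀ t B c → (t + B) + c + c ≡ (t + c + c) + B
    collect = solve-∀
    rotate : ∀ x y z → x + y + z ≡ y + z + x
    rotate = solve-∀
    total : u + v + B + B ≡ t + c + c + B
    total = begin-equality
      u + v + B + B          ≡⟨ pair u v B ⟩
      (u + B) + (v + B)      ≡⟨ cong₂ _+_ (m∸n+n≡m B≤r₁+c) (m∸n+n≡m B≤r₂+c) ⟩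
      (r₁ + c) + (r₂ + c)    ≡⟨ spread r₁ r₂ c ⟩
      (r₁ + r₂) + c + c      ≡⟨ cong (λ x → x + c + c) r₁+r₂≡t+B ⟩
      (t + B) + c + c        ≡⟨ collect t B c ⟩
      t + c + c + B          ∎
  ... | yes _ | no B≰r₂+c = begin
    ((r₁ + c) ∸ B) + ((r₂ + c) ∸ B)  ≡⟨ cong ((r₁ + c) ∸ B +_) (m≤n⇒m∸n≡0 (<⇒≤ (≰⇒> B≰r₂+c))) ⟩
    (r₁ + c) ∸ B + 0             ≤⟨ +-monoˡ-≤ 0 (overflow≤ r₁ c r₁<B) ⟩
    c + 0                        ≤⟨ +-monoʳ-≤ c z≤n ⟩
    c + ((t + c) ∸ B)            ≡⟨ +-comm c _ ⟩
    (t + c) ∸ B + c              ∎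
    where open ≤-Reasoning
  ... | no B≰r₁+c | _ = begin
    ((r₁ + c) ∸ B) + ((r₂ + c) ∸ B)  ≡⟨ cong (_+ ((r₂ + c) ∸ B)) (m≤n⇒m∸n≡0 (<⇒≤ (≰⇒> B≰r₁+c))) ⟩
    (r₂ + c) ∸ B                 ≤⟨ overflow≤ r₂ c r₂<B ⟩
    c                            ≤⟨ m≤n+m c _ ⟩
    (t + c) ∸ B + c              ∎
    where open ≤-Reasoning

  -- Superadditivity on residues: compare overflows, wrapping once when r₁ + r₂ ≥ B.
  window-superadditive-residues : ∀ c r₁ r₂ → c ≤ B → r₁ < B → r₂ < B →
                                  window quot r₁ c + window quot r₂ c ≤ window quot (r₁ + r₂) c
  window-superadditive-residues c r₁ r₂ c≤B r₁<B r₂<B with B ≤? r₁ + r₂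
  ... | no B≰r₁+r₂ = begin
    window quot r₁ c + window quot r₂ c  ≡⟨ cong₂ _+_ (window-residue c r₁ r₁<B c≤B) (window-residue c r₂ r₂<B c≤B) ⟩
    ((r₁ + c) ∸ B) + ((r₂ + c) ∸ B)      ≤⟨ overflow-superadditive r₁ r₂ c c≤B ⟩
    (r₁ + r₂ + c) ∸ B                    ≡⟨ sym (window-residue c (r₁ + r₂) (≰⇒> B≰r₁+r₂) c≤B) ⟩
    window quot (r₁ + r₂) c              ∎
    where open ≤-Reasoning
  ... | yes B≤r₁+r₂ = begin
    window quot r₁ c + window quot r₂ c  ≡⟨ cong₂ _+_ (window-residue c r₁ r₁<B c≤B) (window-residue c r₂ r₂<B c≤B) ⟩
    ((r₁ + c) ∸ B) + ((r₂ + c) ∸ B)      ≤⟨ overflow-wrap r₁ r₂ c t r₁<B r₂<B c≤B (sym (m∸n+n≡m B≤r₁+r₂)) ⟩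
    ((t + c) ∸ B) + c                    ≡⟨ cong₂ _+_ (sym (window-residue c t t<B c≤B)) (sym (*-identityʳ c)) ⟩
    window quot t c + c * 1              ≡⟨ sym (window-periodic c t 1) ⟩
    window quot (t + 1 * B) c            ≡⟨ cong (λ w → window quot (t + w) c) (*-identityˡ B) ⟩
    window quot (t + B) c                ≡⟨ cong (λ w → window quot w c) (m∸n+n≡m B≤r₁+r₂) ⟩
    window quot (r₁ + r₂) c              ∎
    where
    open ≤-Reasoning
    t : ℕ
    t = (r₁ + r₂) ∸ B
    t<B : t < B
    t<B = m<n+o⇒m∸n<o (r₁ + r₂) B (+-mono-< r₁<B r₂<B)

  window-superadditive : ∀ c x y → c ≤ B → window quot x c + window quot y c ≤ window quot (x + y) c
  window-superadditive c x y c≤B = begin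
    window quot x c + window quot y c
      ≡⟨ cong₂ _+_ (window-reduce x c) (window-reduce y c) ⟩
    (window quot r₁ c + c * q₁) + (window quot r₂ c + c * q₂)
      ≡⟨ regroup (window quot r₁ c) (window quot r₂ c) c q₁ q₂ ⟩
    (window quot r₁ c + window quot r₂ c) + c * (q₁ + q₂)
      ≤⟨ +-monoˡ-≤ (c * (q₁ + q₂)) (window-superadditive-residues c r₁ r₂ c≤B (m%n<n x B) (m%n<n y B)) ⟩
    window quot (r₁ + r₂) c + c * (q₁ + q₂)
      ≡⟨ sym (window-periodic c (r₁ + r₂) (q₁ + q₂)) ⟩
    window quot (r₁ + r₂ + (q₁ + q₂) * B) c
      ≡⟨ cong (λ w → window quot w c) (sym x+y≡) ⟩
    window quot (x + y) c ∎
    where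
    open ≤-Reasoning
    r₁ r₂ q₁ q₂ : ℕ
    r₁ = x % B
    r₂ = y % B
    q₁ = x / B
    q₂ = y / B
    regroup : ∀ w₁ w₂ c q₁ q₂ → (w₁ + c * q₁) + (w₂ + c * q₂) ≡ (w₁ + w₂) + c * (q₁ + q₂)
    regroup = solve-∀
    collect : ∀ r₁ r₂ q₁ q₂ B → (r₁ + q₁ * B) + (r₂ + q₂ * B) ≡ r₁ + r₂ + (q₁ + q₂) * B
    collect = solve-∀
    x+y≡ : x + y ≡ r₁ + r₂ + (q₁ + q₂) * B
    x+y≡ = trans (cong₂ _+_ (m≡m%n+[m/n]*n x B) (m≡m%n+[m/n]*n y B)) (collect r₁ r₂ q₁ q₂ B)

  window-scale : ∀ c a k → c ≤ B → a * window quot k c ≤ window quot (a * k) c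
  window-scale c zero    k c≤B = z≤n
  window-scale c (suc a) k c≤B = begin
    window quot k c + a * window quot k c  ≤⟨ +-monoʳ-≤ (window quot k c) (window-scale c a k c≤B) ⟩
    window quot k c + window quot (a * k) c ≤⟨ window-superadditive c k (a * k) c≤B ⟩
    window quot (k + a * k) c               ∎
    where open ≤-Reasoning

  window-from-residue : ∀ c x → c ≤ B → window quot c x ≡ ∑ quot x + window quot x c
  window-from-residue c x c≤B = begin
    window quot c x            ≡⟨ cong (_+ window quot c x) (sym initial≡0) ⟩
    ∑ quot c + window quot c x ≡⟨ window-swap quot c x ⟩
    ∑ quot x + window quot x c ∎
    where
    open ≡-Reasoning
    initial≡0 : ∑ quot c ≡ 0
    initial≡0 = ∑-vanish quot c (λ j j<c → m<n⇒m/n≡0 (<-≤-trans j<c c≤B))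

  -- For a start c ≤ B the comparison is window-scale, after splitting off ∑ quot.
  floor-comparable-residue : ∀ a c k → c ≤ B → Comparable a quot c k
  floor-comparable-residue a c k c≤B = begin
    ∑ quot (a * k) + a * window quot c k
      ≡⟨ cong (λ w → ∑ quot (a * k) + a * w) (window-from-residue c k c≤B) ⟩
    ∑ quot (a * k) + a * (∑ quot k + window quot k c)
      ≡⟨ regroup (∑ quot (a * k)) a (∑ quot k) (window quot k c) ⟩
    (∑ quot (a * k) + a * window quot k c) + a * ∑ quot k
      ≤⟨ +-monoˡ-≤ (a * ∑ quot k) (+-monoʳ-≤ (∑ quot (a * k)) (window-scale c a k c≤B)) ⟩
    (∑ quot (a * k) + window quot (a * k) c) + a * ∑ quot k
      ≡⟨ cong (_+ a * ∑ quot k) (sym (window-from-residue c (a * k) c≤B)) ⟩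
    window quot c (a * k) + a * ∑ quot k ∎
    where
    open ≤-Reasoning
    regroup : ∀ s a t w → s + a * (t + w) ≡ (s + a * w) + a * t
    regroup = solve-∀

  -- Moving the start from n % B to n adds (a k)·⌊n/B⌋ to both sides.
  floor-comparable : ∀ a n k → Comparable a quot n k
  floor-comparable a n k = subst₂ _≤_ (sym lower≡) (sym upper≡)
    (+-monoˡ-≤ ((a * k) * q) (floor-comparable-residue a r k (<⇒≤ (m%n<n n B))))
    where
    r q : ℕ
    r = n % B
    q = n / B
    regroup : ∀ s a w k q → s + a * (w + k * q) ≡ (s + a * w) + (a * k) * q
    regroup = solve-∀
    swap : ∀ w p t → w + p + t ≡ (w + t) + p
    swap = solve-∀
    lower≡ : lower a quot n k ≡ lower a quot r k + (a * k) * q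
    lower≡ = trans (cong (λ w → ∑ quot (a * k) + a * w) (window-reduce n k))
                   (regroup (∑ quot (a * k)) a (window quot r k) k q)
    upper≡ : upper a quot n k ≡ upper a quot r k + (a * k) * q
    upper≡ = trans (cong (_+ a * ∑ quot k) (window-reduce n (a * k)))
                   (swap (window quot r (a * k)) ((a * k) * q) (a * ∑ quot k))

module Digits (b-1 : ℕ) (1≤b-1 : 1 ≤ b-1) where
  b : ℕ
  b = suc b-1

  quotient< : ∀ x → suc x / b < suc x
  quotient< x = m/n<m (suc x) b (s≤s 1≤b-1)

  fuel-irrelevant : ∀ f g x → x ≤ f → x ≤ g → digitSumFuel b f x ≡ digitSumFuel b g x
  fuel-irrelevant zero    zero    x       _         _         = refl
  fuel-irrelevant zero    (suc g) zero    _         _         = refl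
  fuel-irrelevant (suc f) zero    zero    _         _         = refl
  fuel-irrelevant (suc f) (suc g) zero    _         _         = refl
  fuel-irrelevant zero    (suc g) (suc x) ()        _
  fuel-irrelevant (suc f) zero    (suc x) _         ()
  fuel-irrelevant (suc f) (suc g) (suc x) (s≤s x≤f) (s≤s x≤g) =
    cong (suc x % b +_) (fuel-irrelevant f g (suc x / b) (≤-pred (≤-trans (quotient< x) (s≤s x≤f)))
                                                          (≤-pred (≤-trans (quotient< x) (s≤s x≤g))))

  s-step : ∀ x → s b x ≡ x % b + s b (x / b)
  s-step zero    = refl
  s-step (suc x) = cong (suc x % b +_) (fuel-irrelevant x (suc x / b) (suc x / b) (≤-pred (quotient< x)) ≤-refl)

  -- The digit sum never exceeds the number, so D(x) = x ∸ s(x) below is exact.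
  digitSumFuel≤ : ∀ f x → digitSumFuel b f x ≤ x
  digitSumFuel≤ zero    x       = z≤n
  digitSumFuel≤ (suc f) zero    = z≤n
  digitSumFuel≤ (suc f) (suc x) = begin
    suc x % b + digitSumFuel b f (suc x / b) ≤⟨ +-monoʳ-≤ (suc x % b) (digitSumFuel≤ f (suc x / b)) ⟩
    suc x % b + suc x / b                    ≤⟨ +-monoʳ-≤ (suc x % b) (m≤m*n (suc x / b) b) ⟩
    suc x % b + suc x / b * b                ≡⟨ sym (m≡m%n+[m/n]*n (suc x) b) ⟩
    suc x                                    ∎
    where open ≤-Reasoning

  -- D(x) = x - s(x); it equals (b - 1) · Σ_{i ≥ 1} ⌊x / bⁱ⌋.
  D : ℕ → ℕ
  D x = x ∸ s b x

  s+D : ∀ x → s b x + D x ≡ x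
  s+D x = m+[n∸m]≡n (digitSumFuel≤ x x)

  D-step : ∀ x → D x ≡ b-1 * (x / b) + D (x / b)
  D-step x = +-cancelˡ-≡ (s b x) _ _ (begin
    s b x + D x                             ≡⟨ s+D x ⟩
    x                                       ≡⟨ m≡m%n+[m/n]*n x b ⟩
    x % b + q * b                           ≡⟨ cong (λ w → x % b + w * b) (sym (s+D q)) ⟩
    x % b + (s b q + D q) * b               ≡⟨ regroup (x % b) (s b q) (D q) b-1 ⟩
    (x % b + s b q) + (b-1 * (s b q + D q) + D q) ≡⟨ cong₂ (λ u w → u + (b-1 * w + D q)) (sym (s-step x)) (s+D q) ⟩
    s b x + (b-1 * q + D q)                 ∎)
    where
    open ≡-Reasoning
    q : ℕ
    q = x / b
    regroup : ∀ r t d c → r + (t + d) * suc c ≡ (r + t) + (c * (t + d) + d)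
    regroup = solve-∀

  s-append : ∀ k d → d < b → s b (b * k + d) ≡ s b k + d
  s-append k d d<b = begin
    s b (b * k + d)                        ≡⟨ cong (s b) (trans (+-comm (b * k) d) (cong (d +_) (*-comm b k))) ⟩
    s b (d + k * b)                        ≡⟨ s-step (d + k * b) ⟩
    (d + k * b) % b + s b ((d + k * b) / b) ≡⟨ cong₂ (λ r q → r + s b q) last-digit quotient ⟩
    d + s b k                              ≡⟨ +-comm d (s b k) ⟩
    s b k + d                              ∎
    where
    open ≡-Reasoning
    last-digit : (d + k * b) % b ≡ d
    last-digit = trans ([m+kn]%n≡m%n d k b) (m<n⇒m%n≡m d<b)
    quotient : (d + k * b) / b ≡ k
    quotient = trans (+-distrib-/-∣ʳ d (n∣m*n k)) (cong₂ _+_ (m<n⇒m/n≡0 d<b) (m*n/n≡m k b))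

  block-sum : ∀ k → ∑ (s b) (b * k) ≡ b * ∑ (s b) k + k * triangle b
  block-sum zero    = trans (cong (∑ (s b)) (*-zeroʳ b)) (sym (cong (_+ 0) (*-zeroʳ b)))
  block-sum (suc k) = begin
    ∑ (s b) (b * suc k)                              ≡⟨ cong (∑ (s b)) (trans (*-suc b k) (+-comm b (b * k))) ⟩
    ∑ (s b) (b * k + b)                              ≡⟨ ∑-split (s b) (b * k) b ⟩
    ∑ (s b) (b * k) + window (s b) (b * k) b         ≡⟨ cong₂ _+_ (block-sum k) last-block ⟩
    (b * ∑ (s b) k + k * T) + (b * s b k + T)        ≡⟨ regroup b (∑ (s b) k) k T (s b k) ⟩
    b * (∑ (s b) k + s b k) + suc k * T              ∎
    where
    open ≡-Reasoning
    T : ℕ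
    T = triangle b
    last-block : window (s b) (b * k) b ≡ b * s b k + T
    last-block = trans (∑-cong b (λ d d<b → s-append k d d<b))
                       (trans (∑-+ (λ _ → s b k) (λ d → d) b) (cong (_+ T) (∑-const (s b k) b)))
    regroup : ∀ b σ k t x → (b * σ + k * t) + (b * x + t) ≡ b * (σ + x) + suc k * t
    regroup = solve-∀

  -- Doubling clears the half in 0 + 1 + … + (b - 1) = b (b - 1) / 2.
  block-sum-doubled : ∀ k → 2 * ∑ (s b) (b * k) ≡ 2 * b * ∑ (s b) k + k * b * b-1
  block-sum-doubled k = begin
    2 * ∑ (s b) (b * k)                   ≡⟨ cong (2 *_) (block-sum k) ⟩
    2 * (b * ∑ (s b) k + k * T)           ≡⟨ regroup b (∑ (s b) k) k T ⟩
    2 * b * ∑ (s b) k + k * (2 * T)       ≡⟨ cong (λ w → 2 * b * ∑ (s b) k + k * w) twice-T ⟩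
    2 * b * ∑ (s b) k + k * (b * b-1)     ≡⟨ cong (2 * b * ∑ (s b) k +_) (sym (*-assoc k b b-1)) ⟩
    2 * b * ∑ (s b) k + k * b * b-1       ∎
    where
    open ≡-Reasoning
    T : ℕ
    T = triangle b
    twice-T : 2 * T ≡ b * b-1
    twice-T = +-cancelʳ-≡ b _ _ (trans (triangle-doubled b) (trans (*-suc b b-1) (+-comm b (b * b-1))))
    regroup : ∀ b σ k t → 2 * (b * σ + k * t) ≡ 2 * b * σ + k * (2 * t)
    regroup = solve-∀

  D-quot-step : ∀ B-1 x → D (x / suc B-1) ≡ b-1 * (x / (suc B-1 * b)) + D (x / (suc B-1 * b))
  D-quot-step B-1 x = trans (D-step (x / suc B-1)) (cong (λ q → b-1 * q + D q) (m/n/o≡m/[n*o] x (suc B-1) b))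

  -- x ↦ D(⌊x/B⌋) satisfies the comparison at scale b once all arguments lie below B·bᵗ:
  -- D-quot-step splits off a multiple of the floor function ⌊x/(B b)⌋ and recurses on B b;
  -- after t steps every quotient is 0.
  D-quot-comparable : ∀ t B-1 n k → n + b * k ≤ suc B-1 * b ^ t → Comparable b (λ x → D (x / suc B-1)) n k
  D-quot-comparable zero B-1 n k bound = ≤-reflexive (trans lower≡0 (sym upper≡0))
    where
    f : ℕ → ℕ
    f x = D (x / suc B-1)
    vanish : ∀ m L → m + L ≤ n + b * k → window f m L ≡ 0
    vanish m L m+L≤ = ∑-vanish (λ j → f (m + j)) L (λ j j<L → cong D (m<n⇒m/n≡0
      (<-≤-trans (+-monoʳ-< m j<L) (≤-trans m+L≤ (≤-trans bound (≤-reflexive (*-identityʳ (suc B-1))))))))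
    lower≡0 : lower b f n k ≡ 0 + b * 0
    lower≡0 = cong₂ (λ u v → u + b * v) (vanish 0 (b * k) (m≤n+m (b * k) n)) (vanish n k (+-monoʳ-≤ n (m≤n*m k b)))
    upper≡0 : upper b f n k ≡ 0 + b * 0
    upper≡0 = cong₂ (λ u v → u + b * v) (vanish n (b * k) ≤-refl) (vanish 0 k (≤-trans (m≤n*m k b) (m≤n+m (b * k) n)))
  D-quot-comparable (suc t) B-1 n k bound =
    comparable-cong b n k (D-quot-step B-1)
      (comparable-+ b (λ x → b-1 * (x / (suc B-1 * b))) (λ x → D (x / (suc B-1 * b))) n k
        (comparable-scale b b-1 (λ x → x / (suc B-1 * b)) n k (FloorComparison.floor-comparable (b-1 + B-1 * b) b n k))
        (D-quot-comparable t (b-1 + B-1 * b) n k (≤-trans bound (≤-reflexive (sym (*-assoc (suc B-1) b (b ^ t)))))))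

  -- A level t at which all quotients ⌊x/bᵗ⌋ with x < n vanish: t = n suffices.
  n<b^n : ∀ n → n < b ^ n
  n<b^n zero    = s≤s z≤n
  n<b^n (suc n) = begin-strict
    suc n                   ≡⟨ +-comm 1 n ⟩
    n + 1                   <⟨ +-mono-<-≤ (n<b^n n) (*-mono-≤ 1≤b-1 (<-≤-trans (s≤s z≤n) (n<b^n n))) ⟩
    b ^ n + b-1 * b ^ n     ∎
    where open ≤-Reasoning

  -- D is b-comparable: D-quot-comparable with B = 1 and t = n + b k.
  D-comparable : ∀ n k → Comparable b D n k
  D-comparable n k = comparable-cong b n k (λ x → cong D (sym (n/1≡n x)))
    (D-quot-comparable (n + b * k) 0 n k (≤-trans (<⇒≤ (n<b^n (n + b * k))) (≤-reflexive (sym (*-identityˡ _)))))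

  -- Since s = id - D, the digit sum satisfies the comparison reversed.
  s-reversed : ∀ n k → upper b (s b) n k ≤ lower b (s b) n k
  s-reversed n k = complement-reverses b (s b) D n k s+D (D-comparable n k)

  window-inequality : ∀ n k → 2 * window (s b) n (b * k) ≤ 2 * b * window (s b) n k + k * b * b-1
  window-inequality n k = +-cancelʳ-≤ (2 * b * σ) _ _ (begin
    2 * w₁ + 2 * b * σ                ≡⟨ factor w₁ b σ ⟩
    2 * (w₁ + b * σ)                  ≤⟨ *-monoʳ-≤ 2 (s-reversed n k) ⟩
    2 * (∑ (s b) (b * k) + b * w₂)    ≡⟨ expand (∑ (s b) (b * k)) b w₂ ⟩
    2 * ∑ (s b) (b * k) + 2 * b * w₂  ≡⟨ cong (_+ 2 * b * w₂) (block-sum-doubled k) ⟩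
    (2 * b * σ + e) + 2 * b * w₂      ≡⟨ swap (2 * b * σ) e (2 * b * w₂) ⟩
    (2 * b * w₂ + e) + 2 * b * σ      ∎)
    where
    open ≤-Reasoning
    w₁ w₂ σ e : ℕ
    w₁ = window (s b) n (b * k)
    w₂ = window (s b) n k
    σ = ∑ (s b) k
    e = k * b * b-1
    factor : ∀ w b σ → 2 * w + 2 * b * σ ≡ 2 * (w + b * σ)
    factor = solve-∀
    expand : ∀ x b w → 2 * (x + b * w) ≡ 2 * x + 2 * b * w
    expand = solve-∀
    swap : ∀ x y z → (x + y) + z ≡ (z + y) + x
    swap = solve-∀

S-window : ∀ b .{{_ : NonZero b}} n L → S b (n + L) ≡ S b n + window (s b) n L
S-window b n zero    = trans (cong (S b) (+-identityʳ n)) (sym (+-identityʳ (S b n)))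
S-window b n (suc L) = begin
  S b (n + suc L)                               ≡⟨ cong (S b) (+-suc n L) ⟩
  S b (n + L) + s b (n + L)                     ≡⟨ cong (_+ s b (n + L)) (S-window b n L) ⟩
  S b n + window (s b) n L + s b (n + L)        ≡⟨ +-assoc (S b n) (window (s b) n L) (s b (n + L)) ⟩
  S b n + (window (s b) n L + s b (n + L))      ∎
  where open ≡-Reasoning

+-difference : ∀ x a → ℤ.+ (x + a) ℤ.- ℤ.+ x ≡ ℤ.+ a
+-difference x a = trans (ℤP.[+m]-[+n]≡m⊖n (x + a) x) (trans (ℤP.⊖-≥ (m≤m+n x a)) (cong ℤ.+_ (m+n∸m≡n x a)))

sbar-window : ∀ b .{{_ : NonZero b}} n L .{{_ : NonZero L}} .{{_ : NonZero ((n + L) ∸ n)}} →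
              sbar b n (n + L) ≡ (ℤ.+ window (s b) n L) ℚ./ L
sbar-window b n L = ℚP./-cong (trans (cong (λ t → ℤ.+ t ℤ.- ℤ.+ S b n) (S-window b n L)) (+-difference (S b n) _))
                              (m+n∸m≡n n L)

module Means (b-1 : ℕ) where
  b : ℕ
  b = suc b-1

  as-fraction : ∀ p d-1 → ℚ.toℚᵘ (p ℚ./ suc d-1) ℚᵘ.≃ ℚᵘ.mkℚᵘ p d-1
  as-fraction p d-1 = ℚP.toℚᵘ-fromℚᵘ (ℚᵘ.mkℚᵘ p d-1)

  mean-plus-half : ∀ a k-1 → ℚ.toℚᵘ ((ℤ.+ a) ℚ./ suc k-1 ℚ.+ (ℤ.+ b-1) ℚ./ 2)
                             ℚᵘ.≃ ℚᵘ.mkℚᵘ (ℤ.+ a) k-1 ℚᵘ.+ ℚᵘ.mkℚᵘ (ℤ.+ b-1) 1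
  mean-plus-half a k-1 = ℚᵘP.≃-trans (ℚP.toℚᵘ-homo-+ ((ℤ.+ a) ℚ./ suc k-1) ((ℤ.+ b-1) ℚ./ 2))
                                     (ℚᵘP.+-cong (as-fraction (ℤ.+ a) k-1) (as-fraction (ℤ.+ b-1) 1))

  cross-lhs : ∀ a₁ k → ℤ.+ a₁ ℤ.* ℤ.+ (k * 2) ≡ ℤ.+ (2 * a₁ * k)
  cross-lhs a₁ k = trans (sym (ℤP.pos-* a₁ (k * 2))) (cong ℤ.+_ (reorder a₁ k))
    where
    reorder : ∀ a k → a * (k * 2) ≡ 2 * a * k
    reorder = solve-∀

  cross-rhs : ∀ a₂ k → (ℤ.+ a₂ ℤ.* ℤ.+ 2 ℤ.+ ℤ.+ b-1 ℤ.* ℤ.+ k) ℤ.* ℤ.+ (b * k)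
                       ≡ ℤ.+ ((2 * b * a₂ + k * b * b-1) * k)
  cross-rhs a₂ k = begin
    (ℤ.+ a₂ ℤ.* ℤ.+ 2 ℤ.+ ℤ.+ b-1 ℤ.* ℤ.+ k) ℤ.* ℤ.+ (b * k)
      ≡⟨ cong (ℤ._* ℤ.+ (b * k)) (cong₂ ℤ._+_ (sym (ℤP.pos-* a₂ 2)) (sym (ℤP.pos-* b-1 k))) ⟩
    (ℤ.+ (a₂ * 2) ℤ.+ ℤ.+ (b-1 * k)) ℤ.* ℤ.+ (b * k)
      ≡⟨ cong (ℤ._* ℤ.+ (b * k)) (sym (ℤP.pos-+ (a₂ * 2) (b-1 * k))) ⟩
    ℤ.+ (a₂ * 2 + b-1 * k) ℤ.* ℤ.+ (b * k)
      ≡⟨ sym (ℤP.pos-* (a₂ * 2 + b-1 * k) (b * k)) ⟩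
    ℤ.+ ((a₂ * 2 + b-1 * k) * (b * k))
      ≡⟨ cong ℤ.+_ (reorder a₂ b-1 k) ⟩
    ℤ.+ ((2 * b * a₂ + k * b * b-1) * k) ∎
    where
    open ≡-Reasoning
    reorder : ∀ a c k → (a * 2 + c * k) * (suc c * k) ≡ (2 * suc c * a + k * suc c * c) * k
    reorder = solve-∀

  mean-≤ : ∀ a₁ a₂ k-1 → 2 * a₁ ≤ 2 * b * a₂ + suc k-1 * b * b-1 →
           (ℤ.+ a₁) ℚ./ (b * suc k-1) ℚ.≤ (ℤ.+ a₂) ℚ./ suc k-1 ℚ.+ (ℤ.+ b-1) ℚ./ 2
  mean-≤ a₁ a₂ k-1 ineq = ℚP.toℚᵘ-cancel-≤
    (ℚᵘP.≤-respˡ-≃ (ℚᵘP.≃-sym (as-fraction (ℤ.+ a₁) _))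
      (ℚᵘP.≤-respʳ-≃ (ℚᵘP.≃-sym (mean-plus-half a₂ k-1))
        (ℚᵘ.*≤* (subst₂ ℤ._≤_ (sym (cross-lhs a₁ k)) (sym (cross-rhs a₂ k)) (ℤ.+≤+ (*-monoˡ-≤ k ineq))))))
    where
    k : ℕ
    k = suc k-1

  mean-≡ : ∀ a₁ a₂ k-1 → 2 * a₁ ≡ 2 * b * a₂ + suc k-1 * b * b-1 →
           (ℤ.+ a₁) ℚ./ (b * suc k-1) ≡ (ℤ.+ a₂) ℚ./ suc k-1 ℚ.+ (ℤ.+ b-1) ℚ./ 2
  mean-≡ a₁ a₂ k-1 eq = ℚP.toℚᵘ-injective
    (ℚᵘP.≃-trans (as-fraction (ℤ.+ a₁) _)
      (ℚᵘP.≃-trans (ℚᵘ.*≡* (trans (cross-lhs a₁ k) (trans (cong (λ x → ℤ.+ (x * k)) eq) (sym (cross-rhs a₂ k)))))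
        (ℚᵘP.≃-sym (mean-plus-half a₂ k-1))))
    where
    k : ℕ
    k = suc k-1

theorem4 : (b : ℕ) → .{{_ : NonZero b}} → 2 ≤ b →
    ((n k : ℕ) → .{{_ : NonZero k}} → .{{_ : NonZero ((n + b * k) ∸ n)}} → .{{_ : NonZero ((n + k) ∸ n)}} →
      sbar b n (n + b * k) ℚ.≤ sbar b n (n + k) ℚ.+ ((ℤ.+ (b ∸ 1)) ℚ./ 2))
    × ((k : ℕ) → .{{_ : NonZero k}} → .{{_ : NonZero ((0 + b * k) ∸ 0)}} → .{{_ : NonZero ((0 + k) ∸ 0)}} →
      sbar b 0 (0 + b * k) ≡ sbar b 0 (0 + k) ℚ.+ ((ℤ.+ (b ∸ 1)) ℚ./ 2))
theorem4 (suc b-1) (s≤s 1≤b-1) =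
  (λ { n (suc k-1) →
    subst₂ ℚ._≤_ (sym (sbar-window b n (b * suc k-1))) (sym (cong (ℚ._+ half) (sbar-window b n (suc k-1))))
      (mean-≤ (window (s b) n (b * suc k-1)) (window (s b) n (suc k-1)) k-1 (window-inequality n (suc k-1))) }) ,
  (λ { (suc k-1) →
    trans (sbar-window b 0 (b * suc k-1))
      (trans (mean-≡ (∑ (s b) (b * suc k-1)) (∑ (s b) (suc k-1)) k-1 (block-sum-doubled (suc k-1)))
             (sym (cong (ℚ._+ half) (sbar-window b 0 (suc k-1))))) })
  where
  open Digits b-1 1≤b-1
  open Means b-1 using (mean-≤; mean-≡)
  half : ℚ.ℚ
  half = (ℤ.+ b-1) ℚ./ 2
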